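{- Let $G$ be a finite group. Then the proper power graph $P^{*}(G)$ is a chain graph if and only if $G$ is one of the following: (a) the cyclic group $C_{3}$; (b) a $2$-group of exponent $2$; (c) an EPO group of the form $C_{3}\rtimes P$, where $P$ is a non-cyclic $2$-group of exponent $2$; (d) the symmetric group $S_{3}$.
   Context: The (undirected) power graph $P(G)$ of a group $G$ has vertex set $G$, with distinct $u,v$ adjacent if and only if $u=v^m$ or $v=u^n$ for some positive integers $m,n$. The proper power graph $P^{*}(G)$ is the graph obtained from $P(G)$ by deleting the identity element. A graph is $H$-free if it has no induced subgraph isomorphic to $H$. In this paper a chain graph is a graph that is $\{C_{3}, C_{5}, 2K_{2}\}$-free, where $C_n$ is the cycle of length $n$ and $2K_2$ is the disjoint union of two copies of the complete graph $K_2$. A group is EPO if every non-identity element has prime order. -}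

module Defs where

open import Level using (0ℓ)
open import Data.Nat using (ℕ; zero; suc; _+_; _^_; _<_; _%_)
open import Data.Nat.Primality using (Prime)
open import Data.Fin using (Fin; toℕ)
open import Data.Fin.Subset using (Subset; _∈_; ∣_∣)
open import Data.Product using (Σ; ∃; ∃-syntax; _×_; _,_)
open import Data.Sum using (_⊎_)
open import Relation.Nullary using (¬_)
open import Relation.Binary.PropositionalEquality using (_≡_; _≢_)
open import Algebra.Structures using (IsGroup)
open import Function.Definitions using (Injective; Surjective)

-- A finite group: a group structure on Fin n (every finite group is
-- isomorphic to one of these), with propositional equality.
record FinGroup : Set where
  infixl 7 _∙_
  field
    n       : ℕ
    _∙_     : Fin n → Fin n → Fin n
    ε       : Fin n
    _⁻¹     : Fin n → Fin n
    isGroup : IsGroup _≡_ _∙_ ε _⁻¹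

module _ (G : FinGroup) where
  open FinGroup G

  pow : Fin n → ℕ → Fin n
  pow x zero    = ε
  pow x (suc k) = x ∙ pow x k

  HasOrder : Fin n → ℕ → Set
  HasOrder x k = 0 < k × pow x k ≡ ε × (∀ j → 0 < j → j < k → pow x j ≢ ε)

  EPO : Set
  EPO = ∀ x → x ≢ ε → ∃[ k ] (HasOrder x k × Prime k)

  Adj : Fin n → Fin n → Set
  Adj u v = u ≢ v × ((∃[ m ] (0 < m × u ≡ pow v m)) ⊎ (∃[ m ] (0 < m × v ≡ pow u m)))

  Vtx : Fin n → Set
  Vtx x = x ≢ ε

  HasInducedC3 : Set
  HasInducedC3 = ∃[ a ] ∃[ b ] ∃[ c ]
    (Vtx a × Vtx b × Vtx c × Adj a b × Adj b c × Adj a c)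

  HasInducedC5 : Set
  HasInducedC5 = ∃[ a ] ∃[ b ] ∃[ c ] ∃[ d ] ∃[ f ]
    ( (Vtx a × Vtx b × Vtx c × Vtx d × Vtx f)
    × (a ≢ b × a ≢ c × a ≢ d × a ≢ f × b ≢ c × b ≢ d × b ≢ f × c ≢ d × c ≢ f × d ≢ f)
    × (Adj a b × Adj b c × Adj c d × Adj d f × Adj f a)
    × (¬ Adj a c × ¬ Adj a d × ¬ Adj b d × ¬ Adj b f × ¬ Adj c f))

  HasInduced2K2 : Set
  HasInduced2K2 = ∃[ a ] ∃[ b ] ∃[ c ] ∃[ d ]
    ( (Vtx a × Vtx b × Vtx c × Vtx d)
    × (a ≢ b × a ≢ c × a ≢ d × b ≢ c × b ≢ d × c ≢ d)
    × (Adj a b × Adj c d)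
    × (¬ Adj a c × ¬ Adj a d × ¬ Adj b c × ¬ Adj b d))

  -- P*(G) is a chain graph: {C3, C5, 2K2}-free
  ProperPowerGraphIsChain : Set
  ProperPowerGraphIsChain = ¬ HasInducedC3 × ¬ HasInducedC5 × ¬ HasInduced2K2

  IsoC3 : Set
  IsoC3 = Σ (Fin n → Fin 3) λ φ →
    Injective _≡_ _≡_ φ × Surjective _≡_ _≡_ φ ×
    (∀ x y → toℕ (φ (x ∙ y)) ≡ (toℕ (φ x) + toℕ (φ y)) % 3)

  -- G ≅ S3 = Sym({0,1,2}); permutations are injective maps Fin 3 → Fin 3,
  -- compared pointwise, composed as functions.
  IsoS3 : Set
  IsoS3 = Σ (Fin n → Fin 3 → Fin 3) λ φ →
    (∀ x → Injective _≡_ _≡_ (φ x)) ×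
    (∀ x y i → φ (x ∙ y) i ≡ φ x (φ y i)) ×
    (∀ x y → (∀ i → φ x i ≡ φ y i) → x ≡ y) ×
    (∀ (p : Fin 3 → Fin 3) → Injective _≡_ _≡_ p → ∃[ x ] (∀ i → φ x i ≡ p i))

  TwoGroupExp2 : Set
  TwoGroupExp2 = (∃[ k ] n ≡ 2 ^ k) × (∀ x → x ∙ x ≡ ε)

  IsSubgroup : Subset n → Set
  IsSubgroup H = ε ∈ H × (∀ x y → x ∈ H → y ∈ H → x ∙ y ∈ H) × (∀ x → x ∈ H → x ⁻¹ ∈ H)

  IsNormal : Subset n → Set
  IsNormal H = ∀ g x → x ∈ H → (g ∙ x) ∙ g ⁻¹ ∈ H

  EPOSemidirectC3P : Set
  EPOSemidirectC3P = EPO × ∃[ N ] ∃[ P ]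
    (
      IsSubgroup N × IsNormal N
    × (∃[ g ] (HasOrder g 3 × (∀ x → (x ∈ N → ∃[ k ] x ≡ pow g k) × (∃[ k ] x ≡ pow g k → x ∈ N))))
    × IsSubgroup P
    × (∀ x → x ∈ N → x ∈ P → x ≡ ε)
    × (∀ x → ∃[ a ] ∃[ b ] (a ∈ N × b ∈ P × x ≡ a ∙ b))
    × (∃[ k ] ∣ P ∣ ≡ 2 ^ k)
    × (∀ x → x ∈ P → x ∙ x ≡ ε)
    × ¬ (∃[ g ] (g ∈ P × (∀ x → x ∈ P → ∃[ k ] x ≡ pow g k))))

-- Without an induced triangle every non-identity element x has order 2 or 3, for otherwise x, x²
-- and x⁻¹ form one.  If no element has order 3, G has exponent 2, hence order 2ᵏ.  Otherwise fix g
-- of order 3.  Two distinct subgroups of order 3 would give an induced 2K₂, so every element of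
-- order 3 lies in ⟨g⟩ and every element outside ⟨g⟩ is an involution; it inverts g, because an
-- involution centralising g would give an element of order 6.  Then either G = ⟨g⟩ ≅ C₃, or some
-- s lies outside ⟨g⟩ and the action of G on the three left cosets of ⟨s⟩ identifies G with S₃.
-- Conversely, in C₃, in groups of exponent 2 and in S₃ at most two vertices of P*(G) have a
-- neighbour, whereas each of C₃, C₅ and 2K₂ has three.  No group is of type (c): every involution
-- of P inverts the generator of C₃, else EPO fails at an element of order 6, so the product of two
-- distinct involutions of P centralises it and again has order 6.

module Submission where

open import Defs
open import Level using (0ℓ)
open import Algebra.Bundles using (Group)
open import Algebra.Structures using (IsGroup)
import Algebra.Properties.Group as GroupProperties
open import Data.Nat as ℕ using (ℕ; zero; suc; _+_; _*_; _∸_; _<_; _≤_; z≤n; s≤s)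
open import Data.Nat.Properties
  using (≤-refl; ≤-trans; ≤-reflexive; ≤-antisym; <⇒≤; <⇒≱; <-≤-trans; m∸n+n≡m; m<n⇒0<n∸m;
         *-comm; *-suc; +-suc; +-monoʳ-≤; +-monoˡ-≤; +-identityʳ; m<m+n)
open import Data.Nat.DivMod using (_mod_; _/_; _%_; m≡m%n+[m/n]*n; m%n<n)
open import Data.Nat.Primality using (¬prime[1]; prime?)
open import Data.Nat.Solver using (module +-*-Solver)
open import Data.Fin using (Fin; toℕ) renaming (zero to fzero; suc to fsuc)
open import Data.Fin.Patterns using (0F; 1F; 2F)
open import Data.Fin.Properties using (_≟_; all?; any?; ¬∀⟶∃¬; pigeonhole; injective⇒≤; toℕ-fromℕ<)
open import Data.Fin.Subset using (Subset) renaming (_∈_ to _∈ₛ_)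
open import Data.Fin.Subset.Properties using () renaming (_∈?_ to _∈ₛ?_)
open import Data.List using (List; []; _∷_; _++_; map; length; lookup)
open import Data.List.Properties using (length-++; length-map)
open import Data.List.Membership.Propositional using (_∈_; _∉_)
open import Data.List.Membership.Propositional.Properties
  using (∈-length; ∈-++⁺ˡ; ∈-++⁺ʳ; ∈-++⁻; ∈-map⁺; ∈-map⁻; ∈-lookup)
import Data.List.Membership.DecPropositional as DecMembership
open import Data.List.Relation.Unary.Any using (here; index)
open import Data.List.Relation.Unary.Any.Properties using (lookup-index)
import Data.List.Relation.Unary.All as All
open import Data.List.Relation.Unary.AllPairs using ([]; _∷_)
open import Data.List.Relation.Unary.Unique.Propositional using (Unique)
import Data.List.Relation.Unary.Unique.Propositional.Properties as Unique
open import Data.Product using (∃-syntax; _×_; _,_; proj₁; proj₂)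
open import Data.Sum using (_⊎_; inj₁; inj₂; [_,_]′)
open import Data.Empty using (⊥; ⊥-elim)
open import Function.Base using (_∘_)
open import Function.Bundles using (_⇔_; mk⇔)
open import Function.Definitions using (Injective)
open import Relation.Nullary using (¬_; Dec; yes; no; ¬?; contradiction)
open import Relation.Nullary.Decidable using (toWitness; from-no; _×-dec_; _⊎-dec_; _→-dec_)
open import Relation.Binary.PropositionalEquality
open ≡-Reasoning

-- Fin 3 read as ℤ/3: rot k is i ↦ k + i and ref k is i ↦ k − i, since 2 ≡ −1.
rot ref : Fin 3 → Fin 3 → Fin 3
rot k i = (toℕ k + toℕ i) mod 3
ref k i = (toℕ k + 2 * toℕ i) mod 3

rot-0F : ∀ i → rot 0F i ≡ i
rot-0F = toWitness {a? = all? λ i → rot 0F i ≟ i} _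

rot-at-0F : ∀ k → rot k 0F ≡ k
rot-at-0F = toWitness {a? = all? λ k → rot k 0F ≟ k} _

rot-cube : ∀ k i → rot k (rot k (rot k i)) ≡ i
rot-cube = toWitness {a? = all? λ k → all? λ i → rot k (rot k (rot k i)) ≟ i} _

ref-involutive : ∀ k i → ref k (ref k i) ≡ i
ref-involutive = toWitness {a? = all? λ k → all? λ i → ref k (ref k i) ≟ i} _

nonzero-Fin3-collide : ∀ (a b c : Fin 3) → a ≢ 0F → b ≢ 0F → c ≢ 0F → a ≡ b ⊎ a ≡ c ⊎ b ≡ c
nonzero-Fin3-collide = toWitness {a? = all? λ a → all? λ b → all? λ c →
  ¬? (a ≟ 0F) →-dec ¬? (b ≟ 0F) →-dec ¬? (c ≟ 0F) →-dec ((a ≟ b) ⊎-dec (a ≟ c) ⊎-dec (b ≟ c))} _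

k≡2k⇒k≡0F : ∀ (k : Fin 3) → toℕ k ≡ (toℕ k + toℕ k) % 3 → k ≡ 0F
k≡2k⇒k≡0F = toWitness {a? = all? λ k → (toℕ k ℕ.≟ (toℕ k + toℕ k) % 3) →-dec (k ≟ 0F)} _

private
  Agrees : (Fin 3 → Fin 3) → Fin 3 → Fin 3 → Fin 3 → Set
  Agrees f a b c = f 0F ≡ a × f 1F ≡ b × f 2F ≡ c

  distinct-triples-classified : ∀ (a b c : Fin 3) → a ≢ b → a ≢ c → b ≢ c →
    ∃[ k ] (Agrees (rot k) a b c ⊎ Agrees (ref k) a b c)
  distinct-triples-classified = toWitness {a? = all? λ a → all? λ b → all? λ c →
    ¬? (a ≟ b) →-dec ¬? (a ≟ c) →-dec ¬? (b ≟ c) →-dec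
    any? (λ k → agrees? (rot k) a b c ⊎-dec agrees? (ref k) a b c)} _
    where agrees? = λ f a b c → (f 0F ≟ a) ×-dec (f 1F ≟ b) ×-dec (f 2F ≟ c)

  agrees⇒≗ : ∀ {f p : Fin 3 → Fin 3} → Agrees f (p 0F) (p 1F) (p 2F) → p ≗ f
  agrees⇒≗ (e₀ , e₁ , e₂) 0F = sym e₀
  agrees⇒≗ (e₀ , e₁ , e₂) 1F = sym e₁
  agrees⇒≗ (e₀ , e₁ , e₂) 2F = sym e₂

perm3-classified : (p : Fin 3 → Fin 3) → Injective _≡_ _≡_ p → ∃[ k ] (p ≗ rot k ⊎ p ≗ ref k)
perm3-classified p p-inj
  with distinct-triples-classified (p 0F) (p 1F) (p 2F) (apart λ ()) (apart λ ()) (apart λ ())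
  where
    apart : ∀ {i j} → i ≢ j → p i ≢ p j
    apart i≢j e = contradiction (p-inj e) i≢j
... | k , inj₁ agrees = k , inj₁ (agrees⇒≗ agrees)
... | k , inj₂ agrees = k , inj₂ (agrees⇒≗ agrees)

module _ (G : FinGroup) where

  open FinGroup G
  open IsGroup isGroup using (assoc; identityˡ; identityʳ)
  open DecMembership (_≟_ {n}) using (_∈?_)

  group : Group 0ℓ 0ℓ
  group = record { isGroup = isGroup }

  open GroupProperties group using (∙-cancelˡ; ∙-cancelʳ; identityˡ-unique; identityʳ-unique; inverseʳ-unique)

  infixl 8 _^_
  _^_ : Fin n → ℕ → Fin n
  _^_ = pow G

  ^-+ : ∀ x a b → x ^ (a + b) ≡ x ^ a ∙ x ^ b
  ^-+ x zero    b = sym (identityˡ _)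
  ^-+ x (suc a) b = trans (cong (x ∙_) (^-+ x a b)) (sym (assoc _ _ _))

  ε-^ : ∀ k → ε ^ k ≡ ε
  ε-^ zero    = refl
  ε-^ (suc k) = trans (identityˡ _) (ε-^ k)

  ^-*-assoc : ∀ x m k → (x ^ k) ^ m ≡ x ^ (m * k)
  ^-*-assoc x zero    k = refl
  ^-*-assoc x (suc m) k = trans (cong (x ^ k ∙_) (^-*-assoc x m k)) (sym (^-+ x k (m * k)))

  ^-2 : ∀ x → x ^ 2 ≡ x ∙ x
  ^-2 x = cong (x ∙_) (identityʳ x)

  ^-periodic : ∀ {x e} → x ^ e ≡ ε → ∀ q r → x ^ (r + q * e) ≡ x ^ r
  ^-periodic {x} {e} xᵉ≡ε q r = begin
    x ^ (r + q * e)     ≡⟨ ^-+ x r (q * e) ⟩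
    x ^ r ∙ x ^ (q * e) ≡⟨ cong (x ^ r ∙_) (sym (^-*-assoc x q e)) ⟩
    x ^ r ∙ (x ^ e) ^ q ≡⟨ cong (λ y → x ^ r ∙ y ^ q) xᵉ≡ε ⟩
    x ^ r ∙ ε ^ q       ≡⟨ cong (x ^ r ∙_) (ε-^ q) ⟩
    x ^ r ∙ ε           ≡⟨ identityʳ _ ⟩
    x ^ r               ∎

  ^-mod3 : ∀ {x} → x ^ 3 ≡ ε → ∀ m → x ^ m ≡ x ^ toℕ (m mod 3)
  ^-mod3 {x} x³≡ε m = begin
    x ^ m                   ≡⟨ cong (x ^_) (m≡m%n+[m/n]*n m 3) ⟩
    x ^ (m % 3 + m / 3 * 3) ≡⟨ ^-periodic x³≡ε (m / 3) (m % 3) ⟩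
    x ^ (m % 3)             ≡⟨ cong (x ^_) (toℕ-fromℕ< (m%n<n m 3)) ⟨
    x ^ toℕ (m mod 3)       ∎

  exponent : ∀ x → ∃[ e ] (0 < e × x ^ e ≡ ε)
  exponent x with pigeonhole ≤-refl (λ (i : Fin (suc n)) → x ^ toℕ i)
  ... | i , j , i<j , xⁱ≡xʲ = toℕ j ∸ toℕ i , m<n⇒0<n∸m i<j , identityˡ-unique _ _ (begin
    x ^ (toℕ j ∸ toℕ i) ∙ x ^ toℕ i ≡⟨ ^-+ x (toℕ j ∸ toℕ i) (toℕ i) ⟨
    x ^ (toℕ j ∸ toℕ i + toℕ i)     ≡⟨ cong (x ^_) (m∸n+n≡m (<⇒≤ i<j)) ⟩
    x ^ toℕ j                       ≡⟨ xⁱ≡xʲ ⟨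
    x ^ toℕ i                       ∎)

  x²≡ε⇒x³≡ε⇒x≡ε : ∀ {x} → x ^ 2 ≡ ε → x ^ 3 ≡ ε → x ≡ ε
  x²≡ε⇒x³≡ε⇒x≡ε {x} x²≡ε x³≡ε = begin
    x         ≡⟨ identityʳ x ⟨
    x ∙ ε     ≡⟨ cong (x ∙_) x²≡ε ⟨
    x ∙ x ^ 2 ≡⟨ x³≡ε ⟩
    ε         ∎

  -- x, x² and x⁻¹ = x^(e∸1) form a triangle as soon as the exponent e of x exceeds 3.
  ¬C3⇒x²≡ε⊎x³≡ε : ¬ HasInducedC3 G → ∀ x → x ≢ ε → x ^ 2 ≡ ε ⊎ x ^ 3 ≡ ε
  ¬C3⇒x²≡ε⊎x³≡ε noC3 x x≢ε with x ^ 2 ≟ ε | x ^ 3 ≟ ε | exponent x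
  ... | yes x²≡ε | _        | _                  = inj₁ x²≡ε
  ... | no _     | yes x³≡ε | _                  = inj₂ x³≡ε
  ... | no _     | no _     | 0 , () , _
  ... | no _     | no _     | 1 , _ , x¹≡ε       = contradiction (trans (sym (identityʳ x)) x¹≡ε) x≢ε
  ... | no x²≢ε  | no _     | 2 , _ , x²≡ε       = contradiction x²≡ε x²≢ε
  ... | no x²≢ε  | no x³≢ε  | suc (suc (suc t)) , _ , x∙x⁻¹≡ε =
    ⊥-elim (noC3 (x , x ^ 2 , x⁻¹ , x≢ε , x²≢ε , x⁻¹≢ε
                 , (x≢x² , inj₂ (2 , s≤s z≤n , refl))
                 , (x²≢x⁻¹ , inj₁ (1 + t , s≤s z≤n , sym x⁻¹^[1+t]≡x²))
                 , (x≢x⁻¹ , inj₂ (2 + t , s≤s z≤n , refl))))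
    where
      x⁻¹ = x ^ (2 + t)
      x⁻¹≢ε : x⁻¹ ≢ ε
      x⁻¹≢ε x⁻¹≡ε = x≢ε (trans (sym (identityʳ x)) (trans (cong (x ∙_) (sym x⁻¹≡ε)) x∙x⁻¹≡ε))
      x≢x² : x ≢ x ^ 2
      x≢x² x≡x² = x≢ε (trans (sym (identityʳ x)) (identityʳ-unique x (x ^ 1) (sym x≡x²)))
      x≢x⁻¹ : x ≢ x⁻¹
      x≢x⁻¹ x≡x⁻¹ = x²≢ε (trans (^-2 x) (trans (cong (x ∙_) x≡x⁻¹) x∙x⁻¹≡ε))
      x²≢x⁻¹ : x ^ 2 ≢ x⁻¹
      x²≢x⁻¹ x²≡x⁻¹ = x³≢ε (trans (cong (x ∙_) x²≡x⁻¹) x∙x⁻¹≡ε)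
      exponents : (1 + t) * (2 + t) ≡ 2 + t * (3 + t)
      exponents = solve 1 (λ t → (con 1 :+ t) :* (con 2 :+ t) := con 2 :+ t :* (con 3 :+ t)) refl t
        where open +-*-Solver
      x⁻¹^[1+t]≡x² : x⁻¹ ^ (1 + t) ≡ x ^ 2
      x⁻¹^[1+t]≡x² = begin
        (x ^ (2 + t)) ^ (1 + t) ≡⟨ ^-*-assoc x (1 + t) (2 + t) ⟩
        x ^ ((1 + t) * (2 + t))  ≡⟨ cong (x ^_) exponents ⟩
        x ^ (2 + t * (3 + t))    ≡⟨ ^-periodic x∙x⁻¹≡ε t 2 ⟩
        x ^ 2                    ∎

  x^2≢ε⇒x≢ε : ∀ {x} → x ^ 2 ≢ ε → x ≢ ε
  x^2≢ε⇒x≢ε {x} x²≢ε x≡ε = x²≢ε (trans (cong (_^ 2) x≡ε) (ε-^ 2))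

  module Involution {u : Fin n} (u∙u≡ε : u ∙ u ≡ ε) where

    ∙u∙u : ∀ x → (x ∙ u) ∙ u ≡ x
    ∙u∙u x = trans (assoc _ _ _) (trans (cong (x ∙_) u∙u≡ε) (identityʳ x))

    u∙u∙ : ∀ x → u ∙ (u ∙ x) ≡ x
    u∙u∙ x = trans (sym (assoc _ _ _)) (trans (cong (_∙ x) u∙u≡ε) (identityˡ x))

    u^2≡ε : u ^ 2 ≡ ε
    u^2≡ε = trans (^-2 u) u∙u≡ε

    powers : ∀ m → u ^ m ≡ ε ⊎ u ^ m ≡ u
    powers zero = inj₁ refl
    powers (suc m) with powers m
    ... | inj₁ uᵐ≡ε = inj₂ (trans (cong (u ∙_) uᵐ≡ε) (identityʳ u))
    ... | inj₂ uᵐ≡u = inj₁ (trans (cong (u ∙_) uᵐ≡u) u∙u≡ε)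

    conj-^ : ∀ x m → ((u ∙ x) ∙ u) ^ m ≡ (u ∙ x ^ m) ∙ u
    conj-^ x zero    = sym (trans (cong (_∙ u) (identityʳ u)) u∙u≡ε)
    conj-^ x (suc m) = begin
      ((u ∙ x) ∙ u) ∙ ((u ∙ x) ∙ u) ^ m ≡⟨ cong (((u ∙ x) ∙ u) ∙_) (conj-^ x m) ⟩
      ((u ∙ x) ∙ u) ∙ ((u ∙ x ^ m) ∙ u) ≡⟨ assoc _ _ _ ⟨
      (((u ∙ x) ∙ u) ∙ (u ∙ x ^ m)) ∙ u ≡⟨ cong (_∙ u) (assoc _ _ _) ⟨
      ((((u ∙ x) ∙ u) ∙ u) ∙ x ^ m) ∙ u ≡⟨ cong (λ y → (y ∙ x ^ m) ∙ u) (∙u∙u (u ∙ x)) ⟩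
      ((u ∙ x) ∙ x ^ m) ∙ u             ≡⟨ cong (_∙ u) (assoc _ _ _) ⟩
      (u ∙ (x ∙ x ^ m)) ∙ u             ∎

    conj-involutive : ∀ x → (u ∙ ((u ∙ x) ∙ u)) ∙ u ≡ x
    conj-involutive x = trans (cong (_∙ u) (sym (assoc _ _ _))) (trans (∙u∙u (u ∙ (u ∙ x))) (u∙u∙ x))

    conj-^≡ε : ∀ {x} m → x ^ m ≡ ε → ((u ∙ x) ∙ u) ^ m ≡ ε
    conj-^≡ε {x} m xᵐ≡ε = begin
      ((u ∙ x) ∙ u) ^ m ≡⟨ conj-^ x m ⟩
      (u ∙ x ^ m) ∙ u   ≡⟨ cong (λ y → (u ∙ y) ∙ u) xᵐ≡ε ⟩
      (u ∙ ε) ∙ u       ≡⟨ cong (_∙ u) (identityʳ u) ⟩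
      u ∙ u             ≡⟨ u∙u≡ε ⟩
      ε                 ∎

    conj≡ε⇒≡ε : ∀ {x} → (u ∙ x) ∙ u ≡ ε → x ≡ ε
    conj≡ε⇒≡ε {x} uxu≡ε = begin
      x                           ≡⟨ conj-involutive x ⟨
      (u ∙ ((u ∙ x) ∙ u)) ∙ u     ≡⟨ cong (λ y → (u ∙ y) ∙ u) uxu≡ε ⟩
      (u ∙ ε) ∙ u                 ≡⟨ cong (_∙ u) (identityʳ u) ⟩
      u ∙ u                       ≡⟨ u∙u≡ε ⟩
      ε                           ∎

  commute-^ : ∀ {c g} → c ∙ g ≡ g ∙ c → ∀ m → g ∙ c ^ m ≡ c ^ m ∙ g
  commute-^ {c} {g} c∙g≡g∙c zero    = trans (identityʳ g) (sym (identityˡ g))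
  commute-^ {c} {g} c∙g≡g∙c (suc m) = begin
    g ∙ (c ∙ c ^ m) ≡⟨ assoc _ _ _ ⟨
    (g ∙ c) ∙ c ^ m ≡⟨ cong (_∙ c ^ m) c∙g≡g∙c ⟨
    (c ∙ g) ∙ c ^ m ≡⟨ assoc _ _ _ ⟩
    c ∙ (g ∙ c ^ m) ≡⟨ cong (c ∙_) (commute-^ c∙g≡g∙c m) ⟩
    c ∙ (c ^ m ∙ g) ≡⟨ assoc _ _ _ ⟨
    (c ∙ c ^ m) ∙ g ∎

  ^-distrib-∙ : ∀ {c g} → c ∙ g ≡ g ∙ c → ∀ m → (c ∙ g) ^ m ≡ c ^ m ∙ g ^ m
  ^-distrib-∙ {c} {g} c∙g≡g∙c zero    = sym (identityˡ ε)
  ^-distrib-∙ {c} {g} c∙g≡g∙c (suc m) = begin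
    (c ∙ g) ∙ (c ∙ g) ^ m       ≡⟨ cong ((c ∙ g) ∙_) (^-distrib-∙ c∙g≡g∙c m) ⟩
    (c ∙ g) ∙ (c ^ m ∙ g ^ m)   ≡⟨ assoc _ _ _ ⟩
    c ∙ (g ∙ (c ^ m ∙ g ^ m))   ≡⟨ cong (c ∙_) (assoc _ _ _) ⟨
    c ∙ ((g ∙ c ^ m) ∙ g ^ m)   ≡⟨ cong (λ y → c ∙ (y ∙ g ^ m)) (commute-^ c∙g≡g∙c m) ⟩
    c ∙ ((c ^ m ∙ g) ∙ g ^ m)   ≡⟨ cong (c ∙_) (assoc _ _ _) ⟩
    c ∙ (c ^ m ∙ (g ∙ g ^ m))   ≡⟨ assoc _ _ _ ⟨
    (c ∙ c ^ m) ∙ (g ∙ g ^ m)   ∎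

  Order6 : Fin n → Set
  Order6 h = h ^ 2 ≢ ε × h ^ 3 ≢ ε × h ^ 6 ≡ ε

  -- (t ∙ g)² = g² and (t ∙ g)³ = t.
  commuting-involution-order3⇒Order6 : ∀ {t g} → t ∙ t ≡ ε → t ≢ ε → g ^ 3 ≡ ε → g ≢ ε →
                                       t ∙ g ≡ g ∙ t → Order6 (t ∙ g)
  commuting-involution-order3⇒Order6 {t} {g} t∙t≡ε t≢ε g³≡ε g≢ε tg≡gt =
    (λ h²≡ε → g≢ε (x²≡ε⇒x³≡ε⇒x≡ε (trans (sym h²≡g²) h²≡ε) g³≡ε)) ,
    (λ h³≡ε → t≢ε (trans (sym h³≡t) h³≡ε)) ,
    h⁶≡ε
    where
      open Involution t∙t≡ε using (u^2≡ε)
      h²≡g² : (t ∙ g) ^ 2 ≡ g ^ 2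
      h²≡g² = trans (^-distrib-∙ tg≡gt 2) (trans (cong (_∙ g ^ 2) u^2≡ε) (identityˡ _))
      h³≡t : (t ∙ g) ^ 3 ≡ t
      h³≡t = trans (^-distrib-∙ tg≡gt 3)
                   (trans (cong₂ _∙_ (trans (cong (t ∙_) u^2≡ε) (identityʳ t)) g³≡ε) (identityʳ t))
      h⁶≡ε : (t ∙ g) ^ 6 ≡ ε
      h⁶≡ε = trans (sym (^-*-assoc (t ∙ g) 2 3)) (trans (cong (_^ 2) h³≡t) u^2≡ε)

  ¬C3⇒¬Order6 : ¬ HasInducedC3 G → ∀ {h} → ¬ Order6 h
  ¬C3⇒¬Order6 noC3 {h} (h²≢ε , h³≢ε , _) with ¬C3⇒x²≡ε⊎x³≡ε noC3 h (x^2≢ε⇒x≢ε h²≢ε)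
  ... | inj₁ h²≡ε = h²≢ε h²≡ε
  ... | inj₂ h³≡ε = h³≢ε h³≡ε

  -- The order of h divides 6 but is neither 2 nor 3.
  EPO⇒¬Order6 : EPO G → ∀ {h} → ¬ Order6 h
  EPO⇒¬Order6 epo {h} (h²≢ε , h³≢ε , h⁶≡ε) with epo h (x^2≢ε⇒x≢ε h²≢ε)
  ... | 0 , (() , _) , _
  ... | 1 , _ , isPrime = ¬prime[1] isPrime
  ... | 2 , (_ , h²≡ε , _) , _ = h²≢ε h²≡ε
  ... | 3 , (_ , h³≡ε , _) , _ = h³≢ε h³≡ε
  ... | 4 , _ , isPrime = from-no (prime? 4) isPrime
  ... | 5 , (_ , h⁵≡ε , _) , _ = x^2≢ε⇒x≢ε h²≢ε (trans (sym (identityʳ h)) (trans (cong (h ∙_) (sym h⁵≡ε)) h⁶≡ε))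
  ... | 6 , _ , isPrime = from-no (prime? 6) isPrime
  ... | suc (suc (suc (suc (suc (suc (suc _)))))) , (_ , _ , minimal) , _ =
    minimal 6 (s≤s z≤n) (s≤s (s≤s (s≤s (s≤s (s≤s (s≤s (s≤s z≤n))))))) h⁶≡ε

  -- For g³ = ε, membership in the cyclic subgroup ⟨g⟩.
  infix 4 _∈⟨_⟩ _∈⟨_⟩?
  _∈⟨_⟩ : Fin n → Fin n → Set
  x ∈⟨ g ⟩ = ∃[ i ] x ≡ g ^ toℕ {3} i

  _∈⟨_⟩? : ∀ x g → Dec (x ∈⟨ g ⟩)
  x ∈⟨ g ⟩? = any? λ i → x ≟ g ^ toℕ i

  module Order3 {g : Fin n} (g³≡ε : g ^ 3 ≡ ε) (g≢ε : g ≢ ε) where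

    ^-∈ : ∀ m → g ^ m ∈⟨ g ⟩
    ^-∈ m = m mod 3 , ^-mod3 g³≡ε m

    ε-∈ : ε ∈⟨ g ⟩
    ε-∈ = 0F , refl

    ∙-∈ : ∀ {x y} → x ∈⟨ g ⟩ → y ∈⟨ g ⟩ → x ∙ y ∈⟨ g ⟩
    ∙-∈ (i , refl) (j , refl) = subst (_∈⟨ g ⟩) (^-+ g (toℕ i) (toℕ j)) (^-∈ (toℕ i + toℕ j))

    ∈-^ : ∀ {x} → x ∈⟨ g ⟩ → ∀ m → x ^ m ∈⟨ g ⟩
    ∈-^ (i , refl) m = subst (_∈⟨ g ⟩) (sym (^-*-assoc g m (toℕ i))) (^-∈ (m * toℕ i))

    ∈⇒x³≡ε : ∀ {x} → x ∈⟨ g ⟩ → x ^ 3 ≡ ε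
    ∈⇒x³≡ε (i , refl) = begin
      (g ^ toℕ i) ^ 3 ≡⟨ ^-*-assoc g 3 (toℕ i) ⟩
      g ^ (3 * toℕ i) ≡⟨ cong (g ^_) (*-comm 3 (toℕ i)) ⟩
      g ^ (toℕ i * 3) ≡⟨ ^-periodic {e = 3} g³≡ε (toℕ i) 0 ⟩
      ε               ∎

    ∈-cancelˡ : ∀ {x y} → x ∈⟨ g ⟩ → x ∙ y ∈⟨ g ⟩ → y ∈⟨ g ⟩
    ∈-cancelˡ {x} {y} x∈ xy∈ = subst (_∈⟨ g ⟩) x²∙xy≡y (∙-∈ (∈-^ x∈ 2) xy∈)
      where
        x²∙xy≡y : x ^ 2 ∙ (x ∙ y) ≡ y
        x²∙xy≡y = begin
          x ^ 2 ∙ (x ∙ y)     ≡⟨ assoc _ _ _ ⟨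
          (x ^ 2 ∙ x) ∙ y     ≡⟨ cong (λ z → (x ^ 2 ∙ z) ∙ y) (identityʳ x) ⟨
          (x ^ 2 ∙ x ^ 1) ∙ y ≡⟨ cong (_∙ y) (^-+ x 2 1) ⟨
          x ^ 3 ∙ y           ≡⟨ cong (_∙ y) (∈⇒x³≡ε x∈) ⟩
          ε ∙ y               ≡⟨ identityˡ y ⟩
          y                   ∎

    gen¹≢ε : g ^ 1 ≢ ε
    gen¹≢ε g¹≡ε = g≢ε (trans (sym (identityʳ g)) g¹≡ε)

    gen²≢ε : g ^ 2 ≢ ε
    gen²≢ε g²≡ε = g≢ε (x²≡ε⇒x³≡ε⇒x≡ε g²≡ε g³≡ε)

    gen¹≢gen² : g ^ 1 ≢ g ^ 2
    gen¹≢gen² g¹≡g² = g≢ε (identityˡ-unique g (g ^ 1) (sym g¹≡g²))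

    ^-injective : ∀ i j → g ^ toℕ {3} i ≡ g ^ toℕ j → i ≡ j
    ^-injective 0F 0F _ = refl
    ^-injective 0F 1F e = contradiction (sym e) gen¹≢ε
    ^-injective 0F 2F e = contradiction (sym e) gen²≢ε
    ^-injective 1F 0F e = contradiction e gen¹≢ε
    ^-injective 1F 1F _ = refl
    ^-injective 1F 2F e = contradiction e gen¹≢gen²
    ^-injective 2F 0F e = contradiction e gen²≢ε
    ^-injective 2F 1F e = contradiction (sym e) gen¹≢gen²
    ^-injective 2F 2F _ = refl

    -- The discrete logarithm to base g; a junk 0F outside ⟨g⟩.
    log : Fin n → Fin 3
    log x with x ∈⟨ g ⟩?
    ... | yes (i , _) = i
    ... | no _        = 0F

    log-spec : ∀ {x} → x ∈⟨ g ⟩ → g ^ toℕ (log x) ≡ x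
    log-spec {x} x∈ with x ∈⟨ g ⟩?
    ... | yes (_ , x≡gⁱ) = sym x≡gⁱ
    ... | no x∉          = contradiction x∈ x∉

    log-injective : ∀ {x y} → x ∈⟨ g ⟩ → y ∈⟨ g ⟩ → log x ≡ log y → x ≡ y
    log-injective x∈ y∈ e = trans (sym (log-spec x∈)) (trans (cong (λ i → g ^ toℕ i) e) (log-spec y∈))

    log-^toℕ : ∀ i → log (g ^ toℕ i) ≡ i
    log-^toℕ i = ^-injective _ i (log-spec (i , refl))

    log-^ : ∀ m → log (g ^ m) ≡ m mod 3
    log-^ m = trans (cong log (^-mod3 g³≡ε m)) (log-^toℕ (m mod 3))

  -- ⟨g⟩ ∩ ⟨h⟩ = 1, so the edges g — g² and h — h² induce a 2K₂.
  distinct-order3⇒2K2 : ∀ {g h} → g ^ 3 ≡ ε → g ≢ ε → h ^ 3 ≡ ε → h ≢ ε → ¬ h ∈⟨ g ⟩ →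
                        HasInduced2K2 G
  distinct-order3⇒2K2 {g} {h} g³≡ε g≢ε h³≡ε h≢ε h∉⟨g⟩ =
    g ^ 1 , g ^ 2 , h ^ 1 , h ^ 2
    , (⟨g⟩.gen¹≢ε , ⟨g⟩.gen²≢ε , ⟨h⟩.gen¹≢ε , ⟨h⟩.gen²≢ε)
    , (⟨g⟩.gen¹≢gen² , apart g¹ h¹ , apart g¹ h² , apart g² h¹ , apart g² h² , ⟨h⟩.gen¹≢gen²)
    , ( (⟨g⟩.gen¹≢gen² , inj₂ (2 , s≤s z≤n , sym (^-*-assoc g 2 1)))
      , (⟨h⟩.gen¹≢gen² , inj₂ (2 , s≤s z≤n , sym (^-*-assoc h 2 1))))
    , (nonadjacent g¹ h¹ , nonadjacent g¹ h² , nonadjacent g² h¹ , nonadjacent g² h²)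
    where
      module ⟨g⟩ = Order3 g³≡ε g≢ε
      module ⟨h⟩ = Order3 h³≡ε h≢ε

      common⇒ε : ∀ {x} → x ∈⟨ g ⟩ → x ∈⟨ h ⟩ → x ≡ ε
      common⇒ε _ (0F , x≡ε) = x≡ε
      common⇒ε x∈⟨g⟩ (1F , x≡h¹) =
        contradiction (subst (_∈⟨ g ⟩) (trans x≡h¹ (identityʳ h)) x∈⟨g⟩) h∉⟨g⟩
      common⇒ε {x} x∈⟨g⟩ (2F , x≡h²) =
        contradiction (subst (_∈⟨ g ⟩) x²≡h (⟨g⟩.∈-^ x∈⟨g⟩ 2)) h∉⟨g⟩
        where
          x²≡h : x ^ 2 ≡ h
          x²≡h = begin
            x ^ 2           ≡⟨ cong (_^ 2) x≡h² ⟩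
            (h ^ 2) ^ 2     ≡⟨ ^-*-assoc h 2 2 ⟩
            h ^ (1 + 1 * 3) ≡⟨ ^-periodic {e = 3} h³≡ε 1 1 ⟩
            h ^ 1           ≡⟨ identityʳ h ⟩
            h               ∎

      NonTrivialIn : Fin n → Fin n → Set
      NonTrivialIn x c = x ∈⟨ c ⟩ × x ≢ ε

      g¹ : NonTrivialIn (g ^ 1) g
      g¹ = ⟨g⟩.^-∈ 1 , ⟨g⟩.gen¹≢ε
      g² : NonTrivialIn (g ^ 2) g
      g² = ⟨g⟩.^-∈ 2 , ⟨g⟩.gen²≢ε
      h¹ : NonTrivialIn (h ^ 1) h
      h¹ = ⟨h⟩.^-∈ 1 , ⟨h⟩.gen¹≢ε
      h² : NonTrivialIn (h ^ 2) h
      h² = ⟨h⟩.^-∈ 2 , ⟨h⟩.gen²≢ε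

      apart : ∀ {x y} → NonTrivialIn x g → NonTrivialIn y h → x ≢ y
      apart (x∈ , x≢ε) (y∈ , _) x≡y = x≢ε (common⇒ε x∈ (subst (_∈⟨ h ⟩) (sym x≡y) y∈))

      nonadjacent : ∀ {x y} → NonTrivialIn x g → NonTrivialIn y h → ¬ Adj G x y
      nonadjacent (x∈ , x≢ε) (y∈ , _) (_ , inj₁ (m , _ , x≡yᵐ)) =
        x≢ε (common⇒ε x∈ (subst (_∈⟨ h ⟩) (sym x≡yᵐ) (⟨h⟩.∈-^ y∈ m)))
      nonadjacent (x∈ , _) (y∈ , y≢ε) (_ , inj₂ (m , _ , y≡xᵐ)) =
        y≢ε (common⇒ε (subst (_∈⟨ g ⟩) (sym y≡xᵐ) (⟨g⟩.∈-^ x∈ m)) y∈)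

  -- For an involution u and g³ = ε this says u g u⁻¹ = g⁻¹.
  Inverts : Fin n → Fin n → Set
  Inverts u g = (u ∙ g) ∙ u ≡ g ^ 2

  conj∈⟨g⟩⇒commutes⊎inverts : ∀ {u g} → u ∙ u ≡ ε → g ≢ ε → (u ∙ g) ∙ u ∈⟨ g ⟩ →
                              u ∙ g ≡ g ∙ u ⊎ Inverts u g
  conj∈⟨g⟩⇒commutes⊎inverts {u} {g} u∙u≡ε g≢ε (i , e) with i | e
  ... | 0F | ugu≡ε = contradiction (conj≡ε⇒≡ε ugu≡ε) g≢ε
    where open Involution u∙u≡ε
  ... | 1F | ugu≡g¹ = inj₁ (trans (sym (∙u∙u (u ∙ g))) (cong (_∙ u) (trans ugu≡g¹ (identityʳ g))))
    where open Involution u∙u≡ε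
  ... | 2F | ugu≡g² = inj₂ ugu≡g²

  inverts-^ : ∀ {u g} → u ∙ u ≡ ε → Inverts u g → ∀ i → u ∙ g ^ i ≡ g ^ (2 * i) ∙ u
  inverts-^ {u} {g} u∙u≡ε ugu≡g² zero    = trans (identityʳ u) (sym (identityˡ u))
  inverts-^ {u} {g} u∙u≡ε ugu≡g² (suc i) = begin
    u ∙ (g ∙ g ^ i)               ≡⟨ assoc _ _ _ ⟨
    (u ∙ g) ∙ g ^ i               ≡⟨ cong (_∙ g ^ i) ug≡g²u ⟩
    (g ^ 2 ∙ u) ∙ g ^ i           ≡⟨ assoc _ _ _ ⟩
    g ^ 2 ∙ (u ∙ g ^ i)           ≡⟨ cong (g ^ 2 ∙_) (inverts-^ u∙u≡ε ugu≡g² i) ⟩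
    g ^ 2 ∙ (g ^ (2 * i) ∙ u)     ≡⟨ assoc _ _ _ ⟨
    (g ^ 2 ∙ g ^ (2 * i)) ∙ u     ≡⟨ cong (_∙ u) (^-+ g 2 (2 * i)) ⟨
    g ^ (2 + 2 * i) ∙ u           ≡⟨ cong (λ k → g ^ k ∙ u) (*-suc 2 i) ⟨
    g ^ (2 * suc i) ∙ u           ∎
    where
      open Involution u∙u≡ε
      ug≡g²u : u ∙ g ≡ g ^ 2 ∙ u
      ug≡g²u = trans (sym (∙u∙u (u ∙ g))) (cong (_∙ u) ugu≡g²)

  inverters-product-commutes : ∀ {a b g} → g ^ 3 ≡ ε → a ∙ a ≡ ε → b ∙ b ≡ ε →
                               Inverts a g → Inverts b g → (a ∙ b) ∙ g ≡ g ∙ (a ∙ b)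
  inverters-product-commutes {a} {b} {g} g³≡ε a∙a≡ε b∙b≡ε a-inv b-inv = begin
    (a ∙ b) ∙ g       ≡⟨ assoc _ _ _ ⟩
    a ∙ (b ∙ g)       ≡⟨ cong (λ y → a ∙ (b ∙ y)) (identityʳ g) ⟨
    a ∙ (b ∙ g ^ 1)   ≡⟨ cong (a ∙_) (inverts-^ b∙b≡ε b-inv 1) ⟩
    a ∙ (g ^ 2 ∙ b)   ≡⟨ assoc _ _ _ ⟨
    (a ∙ g ^ 2) ∙ b   ≡⟨ cong (_∙ b) (inverts-^ a∙a≡ε a-inv 2) ⟩
    (g ^ 4 ∙ a) ∙ b   ≡⟨ cong (λ y → (y ∙ a) ∙ b) (trans (^-periodic {e = 3} g³≡ε 1 1) (identityʳ g)) ⟩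
    (g ∙ a) ∙ b       ≡⟨ assoc _ _ _ ⟩
    g ∙ (a ∙ b)       ∎

  ⟨g⟩≡G⇒IsoC3 : ∀ {g} → g ^ 3 ≡ ε → g ≢ ε → (∀ x → x ∈⟨ g ⟩) → IsoC3 G
  ⟨g⟩≡G⇒IsoC3 {g} g³≡ε g≢ε all∈ =
    log , (λ e → log-injective (all∈ _) (all∈ _) e) , (λ i → g ^ toℕ i , λ z≡gⁱ → trans (cong log z≡gⁱ) (log-^toℕ i)) , log-homo
    where
      open Order3 g³≡ε g≢ε
      log-homo : ∀ x y → toℕ (log (x ∙ y)) ≡ (toℕ (log x) + toℕ (log y)) % 3
      log-homo x y = begin
        toℕ (log (x ∙ y))         ≡⟨ cong (toℕ ∘ log) (cong₂ _∙_ (log-spec (all∈ x)) (log-spec (all∈ y))) ⟨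
        toℕ (log (g ^ a ∙ g ^ b)) ≡⟨ cong (toℕ ∘ log) (^-+ g a b) ⟨
        toℕ (log (g ^ (a + b)))   ≡⟨ cong toℕ (log-^ (a + b)) ⟩
        toℕ ((a + b) mod 3)       ≡⟨ toℕ-fromℕ< (m%n<n (a + b) 3) ⟩
        (a + b) % 3               ∎
        where
          a = toℕ (log x)
          b = toℕ (log y)

  module ChainWithOrder3 (noC3 : ¬ HasInducedC3 G) (no2K2 : ¬ HasInduced2K2 G)
                         {g : Fin n} (g³≡ε : g ^ 3 ≡ ε) (g≢ε : g ≢ ε) where

    open Order3 g³≡ε g≢ε

    order3⇒∈⟨g⟩ : ∀ {h} → h ^ 3 ≡ ε → h ≢ ε → h ∈⟨ g ⟩
    order3⇒∈⟨g⟩ {h} h³≡ε h≢ε with h ∈⟨ g ⟩?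
    ... | yes h∈ = h∈
    ... | no h∉  = ⊥-elim (no2K2 (distinct-order3⇒2K2 g³≡ε g≢ε h³≡ε h≢ε h∉))

    ∉⇒≢ε : ∀ {u} → ¬ u ∈⟨ g ⟩ → u ≢ ε
    ∉⇒≢ε u∉ u≡ε = u∉ (subst (_∈⟨ g ⟩) (sym u≡ε) ε-∈)

    ¬commuting-involution : ∀ {u} → u ∙ u ≡ ε → u ≢ ε → u ∙ g ≢ g ∙ u
    ¬commuting-involution u∙u≡ε u≢ε ug≡gu =
      ¬C3⇒¬Order6 noC3 (commuting-involution-order3⇒Order6 u∙u≡ε u≢ε g³≡ε g≢ε ug≡gu)

    ∉⇒involution : ∀ {u} → ¬ u ∈⟨ g ⟩ → u ∙ u ≡ ε
    ∉⇒involution {u} u∉ with ¬C3⇒x²≡ε⊎x³≡ε noC3 u (∉⇒≢ε u∉)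
    ... | inj₁ u²≡ε = trans (sym (^-2 u)) u²≡ε
    ... | inj₂ u³≡ε = contradiction (order3⇒∈⟨g⟩ u³≡ε (∉⇒≢ε u∉)) u∉

    ∉⇒inverts : ∀ {u} → ¬ u ∈⟨ g ⟩ → Inverts u g
    ∉⇒inverts {u} u∉ with conj∈⟨g⟩⇒commutes⊎inverts u∙u≡ε g≢ε ugu∈⟨g⟩
      where
        u∙u≡ε = ∉⇒involution u∉
        open Involution u∙u≡ε
        ugu∈⟨g⟩ = order3⇒∈⟨g⟩ (conj-^≡ε 3 g³≡ε) (g≢ε ∘ conj≡ε⇒≡ε)
    ... | inj₁ ug≡gu = contradiction ug≡gu (¬commuting-involution (∉⇒involution u∉) (∉⇒≢ε u∉))
    ... | inj₂ inverts = inverts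

    ∉∙∉⇒∈ : ∀ {u v} → ¬ u ∈⟨ g ⟩ → ¬ v ∈⟨ g ⟩ → u ∙ v ∈⟨ g ⟩
    ∉∙∉⇒∈ {u} {v} u∉ v∉ with u ∙ v ∈⟨ g ⟩?
    ... | yes uv∈ = uv∈
    ... | no uv∉  = contradiction
      (inverters-product-commutes g³≡ε (∉⇒involution u∉) (∉⇒involution v∉) (∉⇒inverts u∉) (∉⇒inverts v∉))
      (¬commuting-involution (∉⇒involution uv∉) (∉⇒≢ε uv∉))

    ∈∙∉⇒∉ : ∀ {u v} → u ∈⟨ g ⟩ → ¬ v ∈⟨ g ⟩ → ¬ u ∙ v ∈⟨ g ⟩
    ∈∙∉⇒∉ u∈ v∉ uv∈ = v∉ (∈-cancelˡ u∈ uv∈)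

    -- G acts on the three left cosets gⁱ⟨s⟩; rep u is the element of ⟨g⟩ in u⟨s⟩ = {u, u s}.
    module CosetAction {s : Fin n} (s∉ : ¬ s ∈⟨ g ⟩) where

      open Involution (∉⇒involution s∉) using (∙u∙u)

      rep : Fin n → Fin n
      rep u with u ∈⟨ g ⟩?
      ... | yes _ = u
      ... | no _  = u ∙ s

      rep-∈ : ∀ u → rep u ∈⟨ g ⟩
      rep-∈ u with u ∈⟨ g ⟩?
      ... | yes u∈ = u∈
      ... | no u∉  = ∉∙∉⇒∈ u∉ s∉

      rep-∈-coset : ∀ u → rep u ≡ u ⊎ rep u ≡ u ∙ s
      rep-∈-coset u with u ∈⟨ g ⟩?
      ... | yes _ = inj₁ refl
      ... | no _  = inj₂ refl

      rep-∈⟨g⟩ : ∀ {u} → u ∈⟨ g ⟩ → rep u ≡ u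
      rep-∈⟨g⟩ {u} u∈ with u ∈⟨ g ⟩?
      ... | yes _ = refl
      ... | no u∉ = contradiction u∈ u∉

      rep-∉⟨g⟩ : ∀ {u} → ¬ u ∈⟨ g ⟩ → rep u ≡ u ∙ s
      rep-∉⟨g⟩ {u} u∉ with u ∈⟨ g ⟩?
      ... | yes u∈ = contradiction u∈ u∉
      ... | no _   = refl

      rep-∙s : ∀ u → rep (u ∙ s) ≡ rep u
      rep-∙s u with u ∈⟨ g ⟩?
      ... | yes u∈ = trans (rep-∉⟨g⟩ (∈∙∉⇒∉ u∈ s∉)) (∙u∙u u)
      ... | no u∉  = rep-∈⟨g⟩ (∉∙∉⇒∈ u∉ s∉)

      rep-∙-rep : ∀ x u → rep (x ∙ rep u) ≡ rep (x ∙ u)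
      rep-∙-rep x u with rep-∈-coset u
      ... | inj₁ rep≡u  = cong (λ v → rep (x ∙ v)) rep≡u
      ... | inj₂ rep≡us = trans (cong (λ v → rep (x ∙ v)) rep≡us) (trans (cong rep (sym (assoc x u s))) (rep-∙s (x ∙ u)))

      rep-injective : ∀ {u v} → rep u ≡ rep v → u ≡ v ⊎ u ≡ v ∙ s
      rep-injective {u} {v} e with rep-∈-coset u | rep-∈-coset v
      ... | inj₁ ru≡u  | inj₁ rv≡v  = inj₁ (trans (sym ru≡u) (trans e rv≡v))
      ... | inj₁ ru≡u  | inj₂ rv≡vs = inj₂ (trans (sym ru≡u) (trans e rv≡vs))
      ... | inj₂ ru≡us | inj₁ rv≡v  = inj₂ (trans (sym (∙u∙u u)) (cong (_∙ s) (trans (sym ru≡us) (trans e rv≡v))))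
      ... | inj₂ ru≡us | inj₂ rv≡vs = inj₁ (∙-cancelʳ s u v (trans (sym ru≡us) (trans e rv≡vs)))

      g^ : Fin 3 → Fin n
      g^ i = g ^ toℕ i

      φ : Fin n → Fin 3 → Fin 3
      φ x i = log (rep (x ∙ g^ i))

      log-rep-injective : ∀ {u v} → log (rep u) ≡ log (rep v) → u ≡ v ⊎ u ≡ v ∙ s
      log-rep-injective {u} {v} e = rep-injective (log-injective (rep-∈ u) (rep-∈ v) e)

      φ-injective : ∀ x → Injective _≡_ _≡_ (φ x)
      φ-injective x {i} {j} e with log-rep-injective e
      ... | inj₁ xgⁱ≡xgʲ  = ^-injective i j (∙-cancelˡ x (g^ i) (g^ j) xgⁱ≡xgʲ)
      ... | inj₂ xgⁱ≡xgʲs = contradiction (subst (_∈⟨ g ⟩) gⁱ≡gʲs (^-∈ (toℕ i))) (∈∙∉⇒∉ (^-∈ (toℕ j)) s∉)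
        where
          gⁱ≡gʲs : g^ i ≡ g^ j ∙ s
          gⁱ≡gʲs = ∙-cancelˡ x (g^ i) (g^ j ∙ s) (trans xgⁱ≡xgʲs (assoc x (g^ j) s))

      φ-hom : ∀ x y i → φ (x ∙ y) i ≡ φ x (φ y i)
      φ-hom x y i = cong log (begin
        rep ((x ∙ y) ∙ g^ i)     ≡⟨ cong rep (assoc x y (g^ i)) ⟩
        rep (x ∙ (y ∙ g^ i))     ≡⟨ rep-∙-rep x (y ∙ g^ i) ⟨
        rep (x ∙ rep (y ∙ g^ i)) ≡⟨ cong (λ z → rep (x ∙ z)) (log-spec (rep-∈ (y ∙ g^ i))) ⟨
        rep (x ∙ g^ (φ y i))     ∎)

      φ-∙s-moves-1F : ∀ y → φ (y ∙ s) 1F ≢ φ y 1F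
      φ-∙s-moves-1F y e with log-rep-injective e
      ... | inj₁ ysg≡yg  = ∉⇒≢ε s∉ (identityˡ-unique s (g ^ 1) (∙-cancelˡ y _ _ (trans (sym (assoc y s (g ^ 1))) ysg≡yg)))
      ... | inj₂ ysg≡ygs = ¬commuting-involution (∉⇒involution s∉) (∉⇒≢ε s∉) sg≡gs
        where
          sg¹≡g¹s : s ∙ g ^ 1 ≡ g ^ 1 ∙ s
          sg¹≡g¹s = ∙-cancelˡ y _ _ (trans (sym (assoc y s (g ^ 1))) (trans ysg≡ygs (assoc y (g ^ 1) s)))
          sg≡gs : s ∙ g ≡ g ∙ s
          sg≡gs = subst (λ h → s ∙ h ≡ h ∙ s) (identityʳ g) sg¹≡g¹s

      φ-faithful : ∀ x y → (∀ i → φ x i ≡ φ y i) → x ≡ y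
      φ-faithful x y φx≗φy with log-rep-injective (φx≗φy 0F)
      ... | inj₁ xε≡yε  = ∙-cancelʳ ε x y xε≡yε
      ... | inj₂ xε≡yεs = ⊥-elim (φ-∙s-moves-1F y (trans (cong (λ z → φ z 1F) (sym x≡ys)) (φx≗φy 1F)))
        where
          x≡ys : x ≡ y ∙ s
          x≡ys = trans (sym (identityʳ x)) (trans xε≡yεs (cong (_∙ s) (identityʳ y)))

      φ-rot : ∀ k → φ (g^ k) ≗ rot k
      φ-rot k i = begin
        log (rep (g^ k ∙ g^ i))         ≡⟨ cong (log ∘ rep) (^-+ g (toℕ k) (toℕ i)) ⟨
        log (rep (g ^ (toℕ k + toℕ i))) ≡⟨ cong log (rep-∈⟨g⟩ (^-∈ (toℕ k + toℕ i))) ⟩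
        log (g ^ (toℕ k + toℕ i))       ≡⟨ log-^ (toℕ k + toℕ i) ⟩
        rot k i                         ∎

      φ-ref : ∀ k → φ (g^ k ∙ s) ≗ ref k
      φ-ref k i = begin
        log (rep ((g^ k ∙ s) ∙ g^ i))     ≡⟨ cong (log ∘ rep) reflect ⟩
        log (rep (g ^ m ∙ s))             ≡⟨ cong log (rep-∙s (g ^ m)) ⟩
        log (rep (g ^ m))                 ≡⟨ cong log (rep-∈⟨g⟩ (^-∈ m)) ⟩
        log (g ^ m)                       ≡⟨ log-^ m ⟩
        ref k i                           ∎
        where
          m = toℕ k + 2 * toℕ i
          reflect : (g^ k ∙ s) ∙ g^ i ≡ g ^ m ∙ s
          reflect = begin
            (g^ k ∙ s) ∙ g^ i                    ≡⟨ assoc _ _ _ ⟩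
            g^ k ∙ (s ∙ g^ i)                    ≡⟨ cong (g^ k ∙_) (inverts-^ (∉⇒involution s∉) (∉⇒inverts s∉) (toℕ i)) ⟩
            g^ k ∙ (g ^ (2 * toℕ i) ∙ s)         ≡⟨ assoc _ _ _ ⟨
            (g^ k ∙ g ^ (2 * toℕ i)) ∙ s         ≡⟨ cong (_∙ s) (^-+ g (toℕ k) (2 * toℕ i)) ⟨
            g ^ m ∙ s                            ∎

      φ-surjective : ∀ (p : Fin 3 → Fin 3) → Injective _≡_ _≡_ p → ∃[ x ] (∀ i → φ x i ≡ p i)
      φ-surjective p p-inj with perm3-classified p p-inj
      ... | k , inj₁ p≗rot = g^ k     , λ i → trans (φ-rot k i) (sym (p≗rot i))
      ... | k , inj₂ p≗ref = g^ k ∙ s , λ i → trans (φ-ref k i) (sym (p≗ref i))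

      isoS3 : IsoS3 G
      isoS3 = φ , φ-injective , φ-hom , φ-faithful , φ-surjective

  module ExponentTwo (x∙x≡ε : ∀ x → x ∙ x ≡ ε) where

    ∙-comm : ∀ x y → x ∙ y ≡ y ∙ x
    ∙-comm x y = ∙-cancelˡ (x ∙ y) (x ∙ y) (y ∙ x) (trans (x∙x≡ε (x ∙ y)) (sym xy∙yx≡ε))
      where
        xy∙yx≡ε : (x ∙ y) ∙ (y ∙ x) ≡ ε
        xy∙yx≡ε = begin
          (x ∙ y) ∙ (y ∙ x) ≡⟨ assoc x y (y ∙ x) ⟩
          x ∙ (y ∙ (y ∙ x)) ≡⟨ cong (x ∙_) (assoc y y x) ⟨
          x ∙ ((y ∙ y) ∙ x) ≡⟨ cong (λ z → x ∙ (z ∙ x)) (x∙x≡ε y) ⟩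
          x ∙ (ε ∙ x)       ≡⟨ cong (x ∙_) (identityˡ x) ⟩
          x ∙ x             ≡⟨ x∙x≡ε x ⟩
          ε                 ∎

    lookup-injective : ∀ {L : List (Fin n)} → Unique L → Injective _≡_ _≡_ (lookup L)
    lookup-injective (_ ∷ _)   {fzero}  {fzero}  _ = refl
    lookup-injective (x∉ ∷ _)  {fzero}  {fsuc j} e = contradiction e (All.lookup x∉ (∈-lookup j))
    lookup-injective (x∉ ∷ _)  {fsuc i} {fzero}  e = contradiction (sym e) (All.lookup x∉ (∈-lookup i))
    lookup-injective (_ ∷ L!)  {fsuc i} {fsuc j} e = cong fsuc (lookup-injective L! e)

    unique⇒length≤ : ∀ {L} → Unique L → length L ≤ n
    unique⇒length≤ L! = injective⇒≤ (lookup-injective L!)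

    complete⇒length≥ : ∀ {L} → (∀ x → x ∈ L) → n ≤ length L
    complete⇒length≥ {L} complete = injective⇒≤ {f = λ x → index (complete x)} λ {x} {y} e →
      trans (lookup-index (complete x)) (trans (cong (lookup L) e) (sym (lookup-index (complete y))))

    Closed : List (Fin n) → Set
    Closed L = ∀ {a b} → a ∈ L → b ∈ L → a ∙ b ∈ L

    adjoin : Fin n → List (Fin n) → List (Fin n)
    adjoin x L = L ++ map (x ∙_) L

    adjoin-unique : ∀ {x L} → Closed L → x ∉ L → Unique L → Unique (adjoin x L)
    adjoin-unique {x} {L} L-closed x∉L L! = Unique.++⁺ L! (Unique.map⁺ (∙-cancelˡ x _ _) L!) disjoint
      where
        disjoint : ∀ {v} → ¬ (v ∈ L × v ∈ map (x ∙_) L)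
        disjoint (v∈L , v∈xL) with ∈-map⁻ (x ∙_) v∈xL
        ... | b , b∈L , refl = x∉L (subst (_∈ L) xbb≡x (L-closed v∈L b∈L))
          where
            xbb≡x : (x ∙ b) ∙ b ≡ x
            xbb≡x = trans (assoc x b b) (trans (cong (x ∙_) (x∙x≡ε b)) (identityʳ x))

    adjoin-closed : ∀ {x L} → Closed L → Closed (adjoin x L)
    adjoin-closed {x} {L} L-closed {a} {b} a∈ b∈ with ∈-++⁻ L a∈ | ∈-++⁻ L b∈
    ... | inj₁ a∈L | inj₁ b∈L = ∈-++⁺ˡ (L-closed a∈L b∈L)
    ... | inj₁ a∈L | inj₂ b∈xL with ∈-map⁻ (x ∙_) b∈xL
    ...   | b′ , b′∈L , refl = ∈-++⁺ʳ L (subst (_∈ map (x ∙_) L) xab′≡axb′ (∈-map⁺ (x ∙_) (L-closed a∈L b′∈L)))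
      where
        xab′≡axb′ : x ∙ (a ∙ b′) ≡ a ∙ (x ∙ b′)
        xab′≡axb′ = trans (sym (assoc x a b′)) (trans (cong (_∙ b′) (∙-comm x a)) (assoc a x b′))
    adjoin-closed {x} {L} L-closed a∈ b∈ | inj₂ a∈xL | inj₁ b∈L with ∈-map⁻ (x ∙_) a∈xL
    ...   | a′ , a′∈L , refl = ∈-++⁺ʳ L (subst (_∈ map (x ∙_) L) (sym (assoc x a′ _)) (∈-map⁺ (x ∙_) (L-closed a′∈L b∈L)))
    adjoin-closed {x} {L} L-closed a∈ b∈ | inj₂ a∈xL | inj₂ b∈xL with ∈-map⁻ (x ∙_) a∈xL | ∈-map⁻ (x ∙_) b∈xL
    ...   | a′ , a′∈L , refl | b′ , b′∈L , refl = ∈-++⁺ˡ (subst (_∈ L) a′b′≡xa′xb′ (L-closed a′∈L b′∈L))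
      where
        a′b′≡xa′xb′ : a′ ∙ b′ ≡ (x ∙ a′) ∙ (x ∙ b′)
        a′b′≡xa′xb′ = sym (begin
          (x ∙ a′) ∙ (x ∙ b′) ≡⟨ cong (_∙ (x ∙ b′)) (∙-comm x a′) ⟩
          (a′ ∙ x) ∙ (x ∙ b′) ≡⟨ assoc a′ x (x ∙ b′) ⟩
          a′ ∙ (x ∙ (x ∙ b′)) ≡⟨ cong (a′ ∙_) (assoc x x b′) ⟨
          a′ ∙ ((x ∙ x) ∙ b′) ≡⟨ cong (λ z → a′ ∙ (z ∙ b′)) (x∙x≡ε x) ⟩
          a′ ∙ (ε ∙ b′)       ≡⟨ cong (a′ ∙_) (identityˡ b′) ⟩
          a′ ∙ b′             ∎)

    length-adjoin : ∀ x L → length (adjoin x L) ≡ length L + length L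
    length-adjoin x L = trans (length-++ L) (cong (length L +_) (length-map (x ∙_) L))

    -- Adjoining missing elements doubles the subgroup until it is all of G; m bounds the number of steps.
    doubling : ∀ m k {L} → Unique L → Closed L → ε ∈ L → length L ≡ 2 ℕ.^ k → n < m + length L →
               ∃[ k ] n ≡ 2 ℕ.^ k
    doubling m k {L} L! L-closed ε∈L |L|≡2ᵏ n<m+|L| with all? (_∈? L)
    ... | yes complete = k , trans (≤-antisym (complete⇒length≥ complete) (unique⇒length≤ L!)) |L|≡2ᵏ
    ... | no incomplete with ¬∀⟶∃¬ n (_∈ L) (_∈? L) incomplete | m
    ...   | _       | zero   = contradiction (unique⇒length≤ L!) (<⇒≱ n<m+|L|)
    ...   | x , x∉L | suc m′ =
      doubling m′ (suc k) (adjoin-unique L-closed x∉L L!) (adjoin-closed L-closed) (∈-++⁺ˡ ε∈L) |xL|≡2ᵏ⁺¹ bound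
      where
        |xL|≡2ᵏ⁺¹ : length (adjoin x L) ≡ 2 ℕ.^ suc k
        |xL|≡2ᵏ⁺¹ = trans (length-adjoin x L) (trans (cong₂ _+_ |L|≡2ᵏ |L|≡2ᵏ) (cong (2 ℕ.^ k +_) (sym (+-identityʳ _))))
        bound : n < m′ + length (adjoin x L)
        bound = <-≤-trans n<m+|L| (≤-trans (≤-reflexive (sym (+-suc m′ (length L))))
          (+-monoʳ-≤ m′ (≤-trans (+-monoˡ-≤ (length L) (∈-length ε∈L)) (≤-reflexive (sym (length-adjoin x L))))))

    order≡2^k : ∃[ k ] n ≡ 2 ℕ.^ k
    order≡2^k = doubling n 0 (All.[] ∷ []) ε-closed (here refl) refl (m<m+n n (s≤s z≤n))
      where
        ε-closed : Closed (ε ∷ [])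
        ε-closed (here refl) (here refl) = here (identityˡ ε)

  NonIsolated : Fin n → Set
  NonIsolated a = a ≢ ε × ∃[ v ] (v ≢ ε × Adj G a v)

  AtMostTwoNonIsolated : Set
  AtMostTwoNonIsolated = ∀ {a b c} → a ≢ b → a ≢ c → b ≢ c →
                         NonIsolated a → NonIsolated b → NonIsolated c → ⊥

  Adj-sym : ∀ {u v} → Adj G u v → Adj G v u
  Adj-sym (u≢v , inj₁ u-power) = u≢v ∘ sym , inj₂ u-power
  Adj-sym (u≢v , inj₂ v-power) = u≢v ∘ sym , inj₁ v-power

  -- Each of C₃, C₅ and 2K₂ has three distinct non-isolated vertices.
  atMostTwoNonIsolated⇒chain : AtMostTwoNonIsolated → ProperPowerGraphIsChain G
  atMostTwoNonIsolated⇒chain atMostTwo = noC3 , noC5 , no2K2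
    where
      noC3 : ¬ HasInducedC3 G
      noC3 (a , b , c , a≢ε , b≢ε , c≢ε , ab , bc , ac) =
        atMostTwo (proj₁ ab) (proj₁ ac) (proj₁ bc) (a≢ε , b , b≢ε , ab) (b≢ε , c , c≢ε , bc) (c≢ε , a , a≢ε , Adj-sym ac)
      noC5 : ¬ HasInducedC5 G
      noC5 (a , b , c , d , _ , (a≢ε , b≢ε , c≢ε , d≢ε , _) , (a≢b , a≢c , _ , _ , b≢c , _) , (ab , bc , cd , _) , _) =
        atMostTwo a≢b a≢c b≢c (a≢ε , b , b≢ε , ab) (b≢ε , c , c≢ε , bc) (c≢ε , d , d≢ε , cd)
      no2K2 : ¬ HasInduced2K2 G
      no2K2 (a , b , c , d , (a≢ε , b≢ε , c≢ε , d≢ε) , (a≢b , a≢c , _ , b≢c , _) , (ab , cd) , _) =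
        atMostTwo a≢b a≢c b≢c (a≢ε , b , b≢ε , ab) (b≢ε , a , a≢ε , Adj-sym ab) (c≢ε , d , d≢ε , cd)

  labelled⇒atMostTwoNonIsolated : (κ : Fin n → Fin 3) → (∀ {a} → NonIsolated a → κ a ≢ 0F) →
                                  (∀ {a b} → NonIsolated a → NonIsolated b → κ a ≡ κ b → a ≡ b) →
                                  AtMostTwoNonIsolated
  labelled⇒atMostTwoNonIsolated κ κ≢0F κ-injective {a} {b} {c} a≢b a≢c b≢c a● b● c●
    with nonzero-Fin3-collide (κ a) (κ b) (κ c) (κ≢0F a●) (κ≢0F b●) (κ≢0F c●)
  ... | inj₁ κa≡κb        = a≢b (κ-injective a● b● κa≡κb)
  ... | inj₂ (inj₁ κa≡κc) = a≢c (κ-injective a● c● κa≡κc)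
  ... | inj₂ (inj₂ κb≡κc) = b≢c (κ-injective b● c● κb≡κc)

  nonIsolated⇒x³≡ε : (∀ x → x ^ 2 ≡ ε ⊎ x ^ 3 ≡ ε) → ∀ {a} → NonIsolated a → a ^ 3 ≡ ε
  nonIsolated⇒x³≡ε x²≡ε⊎x³≡ε {a} (a≢ε , v , v≢ε , a≢v , edge) with x²≡ε⊎x³≡ε a | edge
  ... | inj₂ a³≡ε | _ = a³≡ε
  ... | inj₁ a²≡ε | inj₂ (m , _ , v≡aᵐ) =
    ⊥-elim ([ v≢ε ∘ trans v≡aᵐ , a≢v ∘ sym ∘ trans v≡aᵐ ]′ (Involution.powers (trans (sym (^-2 a)) a²≡ε) m))
  ... | inj₁ _    | inj₁ (m , _ , a≡vᵐ) with x²≡ε⊎x³≡ε v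
  ...   | inj₁ v²≡ε = ⊥-elim ([ a≢ε ∘ trans a≡vᵐ , a≢v ∘ trans a≡vᵐ ]′ (Involution.powers (trans (sym (^-2 v)) v²≡ε) m))
  ...   | inj₂ v³≡ε = Order3.∈⇒x³≡ε v³≡ε v≢ε (subst (_∈⟨ v ⟩) (sym a≡vᵐ) (Order3.^-∈ v³≡ε v≢ε m))

  exponent2⇒chain : TwoGroupExp2 G → ProperPowerGraphIsChain G
  exponent2⇒chain (_ , x∙x≡ε) = atMostTwoNonIsolated⇒chain λ {a} _ _ _ a● _ _ →
    proj₁ a● (x²≡ε⇒x³≡ε⇒x≡ε (x²≡ε a) (nonIsolated⇒x³≡ε (inj₁ ∘ x²≡ε) a●))
    where
      x²≡ε : ∀ x → x ^ 2 ≡ ε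
      x²≡ε x = trans (^-2 x) (x∙x≡ε x)

  C3⇒chain : IsoC3 G → ProperPowerGraphIsChain G
  C3⇒chain (φ , φ-injective , _ , φ-homo) = atMostTwoNonIsolated⇒chain
    (labelled⇒atMostTwoNonIsolated φ (λ (a≢ε , _) φa≡0F → a≢ε (φ-injective (trans φa≡0F (sym φε≡0F))))
                                     (λ _ _ → φ-injective))
    where
      φε≡0F : φ ε ≡ 0F
      φε≡0F = k≡2k⇒k≡0F (φ ε) (trans (cong (toℕ ∘ φ) (sym (identityˡ ε))) (φ-homo ε ε))

  S3⇒chain : IsoS3 G → ProperPowerGraphIsChain G
  S3⇒chain (φ , φx-injective , φ-homo , φ-faithful , _) =
    atMostTwoNonIsolated⇒chain (labelled⇒atMostTwoNonIsolated (λ x → φ x 0F) label≢0F label-injective)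
    where
      φε≗id : ∀ i → φ ε i ≡ i
      φε≗id i = φx-injective ε (trans (sym (φ-homo ε ε i)) (cong (λ x → φ x i) (identityˡ ε)))

      φ-^2 : ∀ x i → φ (x ^ 2) i ≡ φ x (φ x i)
      φ-^2 x i = trans (φ-homo x (x ^ 1) i) (cong (φ x) (trans (φ-homo x ε i) (cong (φ x) (φε≗id i))))

      φ-^3 : ∀ x i → φ (x ^ 3) i ≡ φ x (φ x (φ x i))
      φ-^3 x i = trans (φ-homo x (x ^ 2) i) (cong (φ x) (φ-^2 x i))

      ≗id⇒≡ε : ∀ {x} → (∀ i → φ x i ≡ i) → x ≡ ε
      ≗id⇒≡ε φx≗id = φ-faithful _ ε λ i → trans (φx≗id i) (sym (φε≗id i))

      rot⇒x³≡ε : ∀ {x} k → (∀ i → φ x i ≡ rot k i) → x ^ 3 ≡ ε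
      rot⇒x³≡ε {x} k φx≗rot = ≗id⇒≡ε λ i → begin
        φ (x ^ 3) i                   ≡⟨ φ-^3 x i ⟩
        φ x (φ x (φ x i))             ≡⟨ cong (λ j → φ x (φ x j)) (φx≗rot i) ⟩
        φ x (φ x (rot k i))           ≡⟨ cong (φ x) (φx≗rot _) ⟩
        φ x (rot k (rot k i))         ≡⟨ φx≗rot _ ⟩
        rot k (rot k (rot k i))       ≡⟨ rot-cube k i ⟩
        i                             ∎

      ref⇒x²≡ε : ∀ {x} k → (∀ i → φ x i ≡ ref k i) → x ^ 2 ≡ ε
      ref⇒x²≡ε {x} k φx≗ref = ≗id⇒≡ε λ i → begin
        φ (x ^ 2) i           ≡⟨ φ-^2 x i ⟩
        φ x (φ x i)           ≡⟨ cong (φ x) (φx≗ref i) ⟩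
        φ x (ref k i)         ≡⟨ φx≗ref _ ⟩
        ref k (ref k i)       ≡⟨ ref-involutive k i ⟩
        i                     ∎

      x²≡ε⊎x³≡ε : ∀ x → x ^ 2 ≡ ε ⊎ x ^ 3 ≡ ε
      x²≡ε⊎x³≡ε x with perm3-classified (φ x) (φx-injective x)
      ... | k , inj₁ φx≗rot = inj₂ (rot⇒x³≡ε k φx≗rot)
      ... | k , inj₂ φx≗ref = inj₁ (ref⇒x²≡ε k φx≗ref)

      rotation : ∀ {a} → NonIsolated a → ∀ i → φ a i ≡ rot (φ a 0F) i
      rotation {a} a● with perm3-classified (φ a) (φx-injective a)
      ... | k , inj₁ φa≗rot = λ i → trans (φa≗rot i) (cong (λ k → rot k i) (sym (trans (φa≗rot 0F) (rot-at-0F k))))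
      ... | k , inj₂ φa≗ref =
        ⊥-elim (proj₁ a● (x²≡ε⇒x³≡ε⇒x≡ε (ref⇒x²≡ε k φa≗ref) (nonIsolated⇒x³≡ε x²≡ε⊎x³≡ε a●)))

      label≢0F : ∀ {a} → NonIsolated a → φ a 0F ≢ 0F
      label≢0F a● φa0F≡0F = proj₁ a● (≗id⇒≡ε λ i →
        trans (rotation a● i) (trans (cong (λ k → rot k i) φa0F≡0F) (rot-0F i)))

      label-injective : ∀ {a b} → NonIsolated a → NonIsolated b → φ a 0F ≡ φ b 0F → a ≡ b
      label-injective a● b● e = φ-faithful _ _ λ i →
        trans (rotation a● i) (trans (cong (λ k → rot k i) e) (sym (rotation b● i)))

  ¬cyclic⇒two-nonidentity : ∀ (P : Subset n) → ε ∈ₛ P →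
    ¬ (∃[ g ] (g ∈ₛ P × (∀ x → x ∈ₛ P → ∃[ k ] x ≡ g ^ k))) →
    ∃[ a ] ∃[ b ] (a ∈ₛ P × a ≢ ε × b ∈ₛ P × b ≢ ε × b ≢ a)
  ¬cyclic⇒two-nonidentity P ε∈P ¬cyclic with any? (λ a → a ∈ₛ? P ×-dec ¬? (a ≟ ε))
  ... | no ¬a = ⊥-elim (¬cyclic (ε , ε∈P , λ x x∈P → 0 , ≡ε x x∈P))
    where
      ≡ε : ∀ x → x ∈ₛ P → x ≡ ε
      ≡ε x x∈P with x ≟ ε
      ... | yes x≡ε = x≡ε
      ... | no x≢ε  = ⊥-elim (¬a (x , x∈P , x≢ε))
  ... | yes (a , a∈P , a≢ε) with any? (λ b → b ∈ₛ? P ×-dec ¬? (b ≟ ε) ×-dec ¬? (b ≟ a))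
  ...   | yes (b , b∈P , b≢ε , b≢a) = a , b , a∈P , a≢ε , b∈P , b≢ε , b≢a
  ...   | no ¬b = ⊥-elim (¬cyclic (a , a∈P , generated))
    where
      generated : ∀ x → x ∈ₛ P → ∃[ k ] x ≡ a ^ k
      generated x x∈P with x ≟ ε | x ≟ a
      ... | yes x≡ε | _       = 0 , x≡ε
      ... | no _    | yes x≡a = 1 , trans x≡a (sym (identityʳ a))
      ... | no x≢ε  | no x≢a  = ⊥-elim (¬b (x , x∈P , x≢ε , x≢a))

  -- Each involution of P inverts the generator g of N, since one centralising g would have order 6;
  -- so the product of two distinct ones centralises g and has order 6.
  ¬EPOSemidirectC3P : ¬ EPOSemidirectC3P G
  ¬EPOSemidirectC3P (epo , N , P , _ , N-normal , (g , (_ , g³≡ε , g-minimal) , N≡⟨g⟩) ,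
                     P-subgroup , _ , _ , _ , P-exp2 , P-noncyclic)
    with ¬cyclic⇒two-nonidentity P (proj₁ P-subgroup) P-noncyclic
  ... | a , b , a∈P , a≢ε , b∈P , b≢ε , b≢a =
    EPO⇒¬Order6 epo (commuting-involution-order3⇒Order6 (P-exp2 _ ab∈P) ab≢ε g³≡ε g≢ε
      (inverters-product-commutes g³≡ε (P-exp2 a a∈P) (P-exp2 b b∈P) (inverts a∈P a≢ε) (inverts b∈P b≢ε)))
    where
      g≢ε : g ≢ ε
      g≢ε g≡ε = g-minimal 1 (s≤s z≤n) (s≤s (s≤s z≤n)) (trans (identityʳ g) g≡ε)

      conj∈⟨g⟩ : ∀ {t} → t ∈ₛ P → (t ∙ g) ∙ t ∈⟨ g ⟩
      conj∈⟨g⟩ {t} t∈P with proj₁ (N≡⟨g⟩ _) tgt∈N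
        where
          g∈N : g ∈ₛ N
          g∈N = proj₂ (N≡⟨g⟩ g) (1 , sym (identityʳ g))
          tgt∈N : (t ∙ g) ∙ t ∈ₛ N
          tgt∈N = subst (λ y → (t ∙ g) ∙ y ∈ₛ N) (sym (inverseʳ-unique t t (P-exp2 t t∈P))) (N-normal t g g∈N)
      ... | k , tgt≡gᵏ = subst (_∈⟨ g ⟩) (sym tgt≡gᵏ) (Order3.^-∈ g³≡ε g≢ε k)

      inverts : ∀ {t} → t ∈ₛ P → t ≢ ε → Inverts t g
      inverts {t} t∈P t≢ε with conj∈⟨g⟩⇒commutes⊎inverts (P-exp2 t t∈P) g≢ε (conj∈⟨g⟩ t∈P)
      ... | inj₁ tg≡gt  = ⊥-elim (EPO⇒¬Order6 epo (commuting-involution-order3⇒Order6 (P-exp2 t t∈P) t≢ε g³≡ε g≢ε tg≡gt))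
      ... | inj₂ t-inv  = t-inv

      ab∈P : a ∙ b ∈ₛ P
      ab∈P = proj₁ (proj₂ P-subgroup) a b a∈P b∈P

      ab≢ε : a ∙ b ≢ ε
      ab≢ε ab≡ε = b≢a (sym (begin
        a             ≡⟨ identityʳ a ⟨
        a ∙ ε         ≡⟨ cong (a ∙_) (P-exp2 b b∈P) ⟨
        a ∙ (b ∙ b)   ≡⟨ assoc a b b ⟨
        (a ∙ b) ∙ b   ≡⟨ cong (_∙ b) ab≡ε ⟩
        ε ∙ b         ≡⟨ identityˡ b ⟩
        b             ∎))

  ¬C3⇒exponent2⊎order3 : ¬ HasInducedC3 G → (∀ x → x ∙ x ≡ ε) ⊎ ∃[ g ] (g ^ 3 ≡ ε × g ≢ ε)
  ¬C3⇒exponent2⊎order3 noC3 with all? (λ x → x ∙ x ≟ ε)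
  ... | yes x∙x≡ε = inj₁ x∙x≡ε
  ... | no ¬exp2 with ¬∀⟶∃¬ n _ (λ x → x ∙ x ≟ ε) ¬exp2
  ...   | g , g∙g≢ε with ¬C3⇒x²≡ε⊎x³≡ε noC3 g (λ g≡ε → g∙g≢ε (trans (cong₂ _∙_ g≡ε g≡ε) (identityˡ ε)))
  ...     | inj₁ g²≡ε = ⊥-elim (g∙g≢ε (trans (sym (^-2 g)) g²≡ε))
  ...     | inj₂ g³≡ε = inj₂ (g , g³≡ε , λ g≡ε → g∙g≢ε (trans (cong₂ _∙_ g≡ε g≡ε) (identityˡ ε)))

  Classified : Set
  Classified = IsoC3 G ⊎ TwoGroupExp2 G ⊎ EPOSemidirectC3P G ⊎ IsoS3 G

  chain⇒classified : ProperPowerGraphIsChain G → Classified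
  chain⇒classified (noC3 , _ , no2K2) with ¬C3⇒exponent2⊎order3 noC3
  ... | inj₁ x∙x≡ε = inj₂ (inj₁ (ExponentTwo.order≡2^k x∙x≡ε , x∙x≡ε))
  ... | inj₂ (g , g³≡ε , g≢ε) with all? (_∈⟨ g ⟩?)
  ...   | yes all∈ = inj₁ (⟨g⟩≡G⇒IsoC3 g³≡ε g≢ε all∈)
  ...   | no ¬all with ¬∀⟶∃¬ n _ (_∈⟨ g ⟩?) ¬all
  ...     | s , s∉ = inj₂ (inj₂ (inj₂ (ChainWithOrder3.CosetAction.isoS3 noC3 no2K2 g³≡ε g≢ε s∉)))

  classified⇒chain : Classified → ProperPowerGraphIsChain G
  classified⇒chain = [ C3⇒chain , [ exponent2⇒chain , [ ⊥-elim ∘ ¬EPOSemidirectC3P , S3⇒chain ]′ ]′ ]′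

mainTheorem1 : (G : FinGroup) →
    ProperPowerGraphIsChain G ⇔ (IsoC3 G ⊎ TwoGroupExp2 G ⊎ EPOSemidirectC3P G ⊎ IsoS3 G)
mainTheorem1 G = mk⇔ (chain⇒classified G) (classified⇒chain G)
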